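{- Let $s<t$ be relatively prime positive integers. For any $(s,t)$-closed beta-set $\beta$ and any positive integer $k$, $\beta\prec\overline{\beta+k}$.
   Context: A beta-set is a finite set of positive integers written decreasingly $\{\beta_1>\dots>\beta_n\}$, with associated partition $P(\beta)=(\beta_1-(n-1),\dots,\beta_n)$. For partitions $P=(P_1,\dots,P_n)$, $Q=(Q_1,\dots,Q_m)$ write $P<Q$ if $n\le m$ and $P_i\le Q_i$ for $i\le n$; $\beta\prec\gamma$ means $P(\beta)<P(\gamma)$. $\beta$ is $(s,t)$-closed if for every $x\in\beta$: $x>s\Rightarrow x-s\in\beta$ and $x>t\Rightarrow x-t\in\beta$. The $(s,t)$-closure of a set $\beta$ of positive integers is $\overline{\beta}=\{x-as-bt: x\in\beta,\ a,b\ge0,\ x>as+bt\}$. $\beta+k=\{x+k:x\in\beta\}$. -}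

module Defs where

open import Data.Nat using (ℕ; zero; suc; _+_; _*_; _∸_; _≤_; _<_; _>_)
open import Data.List using (List; []; _∷_; length; map)
open import Data.List.Relation.Unary.All using (All)
open import Data.List.Relation.Unary.Linked using (Linked)
open import Data.List.Membership.Propositional using (_∈_)
open import Data.Product using (_×_; ∃-syntax)
open import Relation.Binary.PropositionalEquality using (_≡_)

IsBetaSet : List ℕ → Set
IsBetaSet β = Linked _>_ β × All (0 <_) β

partitionOf : List ℕ → List ℕ
partitionOf []       = []
partitionOf (x ∷ xs) = (x ∸ length xs) ∷ partitionOf xs

data _<P_ : List ℕ → List ℕ → Set where
  []<P  : ∀ {Q} → [] <P Q
  _∷<P_ : ∀ {p q P Q} → p ≤ q → P <P Q → (p ∷ P) <P (q ∷ Q)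

_≺_ : List ℕ → List ℕ → Set
β ≺ γ = partitionOf β <P partitionOf γ

IsClosed : ℕ → ℕ → List ℕ → Set
IsClosed s t β = ∀ x → x ∈ β → (s < x → (x ∸ s) ∈ β) × (t < x → (x ∸ t) ∈ β)

InClosure : ℕ → ℕ → List ℕ → ℕ → Set
InClosure s t γ x = ∃[ y ] ∃[ a ] ∃[ b ] (y ∈ γ × a * s + b * t < y × x ≡ y ∸ (a * s + b * t))

shift : ℕ → List ℕ → List ℕ
shift k β = map (_+ k) β

-- Since β is closed under subtracting s and t, every element y - a s - b t of the
-- closure of β + k is either ≤ k (when a s + b t ≥ y - k) or again an element of
-- β + k.  So the closure γ of β + k consists of β + k together with some numbers in
-- [1, k]; its n = |β| largest elements are β₁ + k > … > βₙ + k and |γ| ≤ n + k,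
-- whence P(γ)ᵢ = βᵢ + k - (|γ| - i) ≥ βᵢ - (n - i) = P(β)ᵢ.
module Submission where

open import Defs
open import Data.Nat using (ℕ; _<_; _≤_; _+_; _*_; _∸_; _>_; zero; suc; s≤s; z≤n; _<?_)
open import Data.Nat.Properties
open import Data.Nat.Coprimality using (Coprime)
open import Data.List using (List; []; _∷_; length)
open import Data.List.Membership.Propositional using (_∈_)
open import Data.List.Membership.Propositional.Properties using (∈-map⁺; ∈-map⁻)
open import Data.List.Relation.Unary.Any using (here; there)
open import Data.List.Relation.Unary.All as All using (All; _∷_)
open import Data.List.Relation.Unary.Linked as Linked using (Linked; _∷_)
open import Data.List.Relation.Unary.Linked.Properties using (Linked⇒AllPairs)
import Data.List.Relation.Unary.AllPairs as AllPairs
open import Data.Product as Product using (_×_; _,_; ∃-syntax; proj₁; proj₂)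
open import Data.Sum using (_⊎_; inj₁; inj₂)
open import Relation.Nullary using (yes; no; contradiction)
open import Relation.Binary.PropositionalEquality using (_≡_; refl; sym; trans; cong₂; subst)
open import Function.Bundles using (_⇔_; Equivalence)

SubtractionClosed : ℕ → (ℕ → Set) → Set
SubtractionClosed m P = ∀ {x} → P x → m < x → P (x ∸ m)

subtractionClosed-+ : ∀ {m n P} → SubtractionClosed m P → SubtractionClosed n P →
                      SubtractionClosed (m + n) P
subtractionClosed-+ {m} {n} {P} closed-m closed-n {x} Px m+n<x =
  subst P (∸-+-assoc x m n) (closed-n (closed-m Px m<x) n<x∸m)
  where
  m<x : m < x
  m<x = ≤-<-trans (m≤m+n m n) m+n<x
  n<x∸m : n < x ∸ m
  n<x∸m = subst (_< x ∸ m) (m+n∸m≡n m n) (∸-monoˡ-< m+n<x (m≤m+n m n))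

subtractionClosed-* : ∀ {m P} a → SubtractionClosed m P → SubtractionClosed (a * m) P
subtractionClosed-* zero    closed Px _ = Px
subtractionClosed-* (suc a) closed      = subtractionClosed-+ closed (subtractionClosed-* a closed)

closed⇒∸-combination-∈ : ∀ {s t β} → IsClosed s t β → ∀ a b →
                         SubtractionClosed (a * s + b * t) (_∈ β)
closed⇒∸-combination-∈ closed a b =
  subtractionClosed-+
    (subtractionClosed-* a λ {x} x∈β → proj₁ (closed x x∈β))
    (subtractionClosed-* b λ {x} x∈β → proj₂ (closed x x∈β))

∈⇒InClosure : ∀ {s t γ y} → 0 < y → y ∈ γ → InClosure s t γ y
∈⇒InClosure {y = y} 0<y y∈γ = y , 0 , 0 , y∈γ , 0<y , refl

InClosure-shift⇒≤∨∈shift : ∀ {s t β k y} → IsClosed s t β → InClosure s t (shift k β) y →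
                           y ≤ k ⊎ ∃[ x ] (x ∈ β × y ≡ x + k)
InClosure-shift⇒≤∨∈shift {s} {t} {k = k} closed (_ , a , b , x+k∈ , _ , y≡x+k∸c)
  with ∈-map⁻ (_+ k) x+k∈
... | x , x∈β , refl with a * s + b * t <? x
...   | yes c<x = inj₂ (x ∸ (a * s + b * t) , closed⇒∸-combination-∈ closed a b x∈β c<x ,
                        trans y≡x+k∸c (+-∸-comm k (<⇒≤ c<x)))
...   | no c≮x  = inj₁ (subst (_≤ k) (sym y≡x+k∸c)
                        (subst ((x + k) ∸ (a * s + b * t) ≤_) (m+n∸m≡n x k)
                          (∸-monoʳ-≤ (x + k) (≮⇒≥ c≮x))))

head>tail : ∀ {y ys} → Linked _>_ (y ∷ ys) → All (_< y) ys
head>tail linked = AllPairs.head (Linked⇒AllPairs (λ p q → <-trans q p) linked)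

∈⇒≤head : ∀ {y ys z} → Linked _>_ (y ∷ ys) → z ∈ y ∷ ys → z ≤ y
∈⇒≤head _      (here refl) = ≤-refl
∈⇒≤head linked (there z∈)  = <⇒≤ (All.lookup (head>tail linked) z∈)

length≤head : ∀ {y ys} → IsBetaSet (y ∷ ys) → length (y ∷ ys) ≤ y
length≤head {ys = []}    (_ , 0<y ∷ _)                 = 0<y
length≤head {ys = _ ∷ _} (y>w ∷ linked , _ ∷ positive) = ≤-<-trans (length≤head (linked , positive)) y>w

IsBetaSet-tail : ∀ {y ys} → IsBetaSet (y ∷ ys) → IsBetaSet ys
IsBetaSet-tail = Product.map Linked.tail All.tail

partition-entry-mono : ∀ x k {n n′} → n′ ≤ n + k → x ∸ n ≤ (x + k) ∸ n′
partition-entry-mono x k {n} {n′} n′≤n+k = begin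
  x ∸ n             ≡⟨ sym ([m+n]∸[m+o]≡n∸o k x n) ⟩
  (k + x) ∸ (k + n) ≡⟨ cong₂ _∸_ (+-comm k x) (+-comm k n) ⟩
  (x + k) ∸ (n + k) ≤⟨ ∸-monoʳ-≤ (x + k) n′≤n+k ⟩
  (x + k) ∸ n′      ∎
  where open ≤-Reasoning

record ShiftAbove (k : ℕ) (β γ : List ℕ) : Set where
  field
    shift-∈   : ∀ {x} → x ∈ β → x + k ∈ γ
    ∈-≤∨shift : ∀ {y} → y ∈ γ → y ≤ k ⊎ ∃[ x ] (x ∈ β × y ≡ x + k)

module _ {k : ℕ} where
  open ShiftAbove

  ShiftAbove-[]⇒length≤ : ∀ {γ} → IsBetaSet γ → ShiftAbove k [] γ → length γ ≤ k
  ShiftAbove-[]⇒length≤ {[]}    _    _ = z≤n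
  ShiftAbove-[]⇒length≤ {y ∷ _} beta above with ∈-≤∨shift above (here refl)
  ... | inj₁ y≤k = ≤-trans (length≤head beta) y≤k
  ... | inj₂ (_ , () , _)

  ShiftAbove-head : ∀ {x β y γ} → Linked _>_ (x ∷ β) → Linked _>_ (y ∷ γ) →
                    ShiftAbove k (x ∷ β) (y ∷ γ) → y ≡ x + k
  ShiftAbove-head {x} {y = y} linkedβ linkedγ above =
    ≤-antisym y≤x+k (∈⇒≤head linkedγ (shift-∈ above (here refl)))
    where
    y≤x+k : y ≤ x + k
    y≤x+k with ∈-≤∨shift above (here refl)
    ... | inj₁ y≤k              = ≤-trans y≤k (m≤n+m k x)
    ... | inj₂ (_ , x′∈ , refl) = +-monoˡ-≤ k (∈⇒≤head linkedβ x′∈)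

  ShiftAbove-tail : ∀ {x β y γ} → Linked _>_ (x ∷ β) → Linked _>_ (y ∷ γ) →
                    ShiftAbove k (x ∷ β) (y ∷ γ) → ShiftAbove k β γ
  ShiftAbove-tail {x} {β} {y} {γ} linkedβ linkedγ above = record
    { shift-∈   = shift-∈-tail
    ; ∈-≤∨shift = ∈-≤∨shift-tail
    }
    where
    y≡x+k : y ≡ x + k
    y≡x+k = ShiftAbove-head linkedβ linkedγ above

    shift-∈-tail : ∀ {z} → z ∈ β → z + k ∈ γ
    shift-∈-tail z∈β with shift-∈ above (there z∈β)
    ... | here z+k≡y = contradiction (+-cancelʳ-≡ k _ x (trans z+k≡y y≡x+k))
                                     (<⇒≢ (All.lookup (head>tail linkedβ) z∈β))
    ... | there z+k∈γ = z+k∈γ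

    ∈-≤∨shift-tail : ∀ {w} → w ∈ γ → w ≤ k ⊎ ∃[ x′ ] (x′ ∈ β × w ≡ x′ + k)
    ∈-≤∨shift-tail w∈γ with ∈-≤∨shift above (there w∈γ)
    ... | inj₁ w≤k                     = inj₁ w≤k
    ... | inj₂ (_ , here refl , w≡x+k) = contradiction (trans w≡x+k (sym y≡x+k))
                                                       (<⇒≢ (All.lookup (head>tail linkedγ) w∈γ))
    ... | inj₂ (x′ , there x′∈β , w≡) = inj₂ (x′ , x′∈β , w≡)

  ShiftAbove⇒≺ : ∀ {β γ} → Linked _>_ β → IsBetaSet γ → ShiftAbove k β γ →
                 β ≺ γ × length γ ≤ length β + k
  ShiftAbove⇒≺ {[]}              _ betaγ above = []<P , ShiftAbove-[]⇒length≤ betaγ above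
  ShiftAbove⇒≺ {_ ∷ _} {[]}      _ _     above with shift-∈ above (here refl)
  ... | ()
  ShiftAbove⇒≺ {x ∷ β} {y ∷ γ} linkedβ betaγ@(linkedγ , _) above =
    subst (λ z → x ∸ length β ≤ z ∸ length γ) (sym (ShiftAbove-head linkedβ linkedγ above))
      (partition-entry-mono x k |γ|≤|β|+k)
    ∷<P tail≺ , s≤s |γ|≤|β|+k
    where
    tail-result : β ≺ γ × length γ ≤ length β + k
    tail-result = ShiftAbove⇒≺ (Linked.tail linkedβ) (IsBetaSet-tail betaγ)
                               (ShiftAbove-tail linkedβ linkedγ above)
    tail≺ : β ≺ γ
    tail≺ = proj₁ tail-result
    |γ|≤|β|+k : length γ ≤ length β + k
    |γ|≤|β|+k = proj₂ tail-result

lemma4p1 : (s t : ℕ) → 0 < s → s < t → Coprime s t →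
    (β : List ℕ) → IsBetaSet β → IsClosed s t β →
    (k : ℕ) → 0 < k →
    (γ : List ℕ) → IsBetaSet γ → (∀ x → (x ∈ γ) ⇔ InClosure s t (shift k β) x) →
    β ≺ γ
lemma4p1 s t _ _ _ β (linkedβ , _) closed k 0<k γ betaγ γ≡closure =
  proj₁ (ShiftAbove⇒≺ linkedβ betaγ above)
  where
  above : ShiftAbove k β γ
  above = record
    { shift-∈   = λ {x} x∈β → Equivalence.from (γ≡closure (x + k))
                    (∈⇒InClosure (<-≤-trans 0<k (m≤n+m k x)) (∈-map⁺ (_+ k) x∈β))
    ; ∈-≤∨shift = λ {y} y∈γ → InClosure-shift⇒≤∨∈shift closed (Equivalence.to (γ≡closure y) y∈γ)
    }
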